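{- Let $\mathfrak h\subseteq\Phi^+$ be a Hessenberg set, let $v$ be a cover of $w$, and let $s_i$ be a simple reflection with $\ell(s_iw)=\ell(w)+1=\ell(v)$ and $s_iw\neq v$. Then $s_iv>v$ in Bruhat order and $\ell(s_iv)=\ell(s_iw)+1$. Further, $w\to v$ is an edge of $\Gamma_{\mathfrak h}$ if and only if $s_iw\to s_iv$ is an edge of $\Gamma_{\mathfrak h}$.
   Context: $\Phi$ is a crystallographic root system in a real inner product space with base $\Delta=\{\alpha_1,\dots,\alpha_k\}$, positive roots $\Phi^+$, $\Phi^-=-\Phi^+$; $s_\alpha$ is the reflection in $\alpha$, $s_i=s_{\alpha_i}$, $W$ the Weyl group with length function $\ell$. Bruhat order $<$ on $W$: transitive closure of $u<s_\alpha u$ for $\alpha\in\Phi^+$ with $(s_\alpha u)^{ -1}\alpha\in\Phi^-$. Order on $\Phi$: $\alpha\preceq\beta$ iff $\beta-\alpha$ is a nonnegative integer combination of simple roots. A Hessenberg set is $\mathfrak h\subseteq\Phi^+$ with $\Phi^+\setminus\mathfrak h$ upward closed in $\Phi^+$ under $\preceq$. The Hessenberg graph $\Gamma_{\mathfrak h}$ has vertex set $W$ and a directed edge $u\to w$ whenever $w=s_\alpha u$ with $\alpha\in\Phi^+$ and $w^{ -1}\alpha\in-\mathfrak h$. $v$ is a cover of $w$ if $v=s_\alpha w$ for some $\alpha\in\Phi^+$ and $\ell(v)=\ell(w)+1$.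
   Formalization: The root system $\Phi$ lies in ℚ^n with a rational-valued inner product rather than in a real inner product space. -}

module Defs where

open import Data.Nat using (ℕ; zero; suc) renaming (_≤_ to _≤ℕ_)
open import Data.Integer using (ℤ)
open import Data.Rational
  using (ℚ; 0ℚ; 1ℚ; _+_; _*_; -_; _<_; _≟_; 1/_; ≢-nonZero; _/_)
open import Data.Fin using (Fin)
open import Data.Vec using (Vec; []; _∷_; zipWith; map; foldr; replicate; lookup; tabulate)
open import Data.List using (List; []; _∷_; reverse; length) renaming (map to mapL)
open import Data.List.Membership.Propositional using (_∈_)
open import Data.List.Relation.Unary.All using (All)
open import Data.Product using (Σ; ∃; _×_; _,_)
open import Data.Sum using (_⊎_)
open import Relation.Binary.PropositionalEquality using (_≡_; _≢_)
open import Relation.Nullary using (¬_; yes; no)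
open import Function.Bundles using (_⇔_)

V : ℕ → Set
V n = Vec ℚ n

zeroV : ∀ {n} → V n
zeroV {n} = replicate n 0ℚ

_+v_ : ∀ {n} → V n → V n → V n
_+v_ = zipWith _+_

_·v_ : ∀ {n} → ℚ → V n → V n
c ·v x = map (c *_) x

negV : ∀ {n} → V n → V n
negV = map -_

sumℚ : ∀ {m} → Vec ℚ m → ℚ
sumℚ = foldr _ _+_ 0ℚ

sumV : ∀ {n m} → Vec (V n) m → V n
sumV = foldr _ _+v_ zeroV

-- multiplicative inverse, with the (irrelevant) convention inv 0 = 0
inv : ℚ → ℚ
inv p with p ≟ 0ℚ
... | yes _ = 0ℚ
... | no ne = (1/ p) {{≢-nonZero ne}}

two : ℚ
two = 1ℚ + 1ℚ

ℕtoℚ : ℕ → ℚ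
ℕtoℚ n = Data.Integer.+ n / 1

ℤtoℚ : ℤ → ℚ
ℤtoℚ z = z / 1

-- The setting: an inner product on ℚ^n given by a Gram matrix G,
-- a finite list of roots Φ, and an indexed family Δ = (α_1,…,α_k).

module RS {n k : ℕ} (G : Vec (Vec ℚ n) n) (Φ : List (V n)) (Δ : Vec (V n) k) where

  ⟨_,_⟩ : V n → V n → ℚ
  ⟨ x , y ⟩ = sumℚ (zipWith _*_ x (map (λ row → sumℚ (zipWith _*_ row y)) G))

  s : V n → V n → V n
  s α x = x +v (negV ((two * ⟨ x , α ⟩ * inv ⟨ α , α ⟩) ·v α))

  combℚ : (Fin k → ℚ) → V n
  combℚ c = sumV (tabulate (λ i → c i ·v lookup Δ i))

  combℕ : (Fin k → ℕ) → V n
  combℕ c = combℚ (λ i → ℕtoℚ (c i))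

  record IsInnerProduct : Set where
    field
      symmetric    : ∀ i j → lookup (lookup G i) j ≡ lookup (lookup G j) i
      posDefinite  : ∀ x → x ≢ zeroV → 0ℚ < ⟨ x , x ⟩

  record IsCrystallographicRootSystemWithBase : Set where
    field
      innerProduct     : IsInnerProduct
      spanning         : ∀ (x : V n) → ∃ λ (c : Fin k → ℚ) → x ≡ combℚ c
      nonzero          : ∀ {α} → α ∈ Φ → α ≢ zeroV
      reduced          : ∀ {α} (c : ℚ) → α ∈ Φ → (c ·v α) ∈ Φ → c ≡ 1ℚ ⊎ c ≡ - 1ℚ
      reflectionClosed : ∀ {α β} → α ∈ Φ → β ∈ Φ → s α β ∈ Φ
      crystallographic : ∀ {α β} → α ∈ Φ → β ∈ Φ →
                         ∃ λ (z : ℤ) → two * ⟨ β , α ⟩ * inv ⟨ α , α ⟩ ≡ ℤtoℚ z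
      simpleRoots      : ∀ i → lookup Δ i ∈ Φ
      linIndependent   : ∀ (c : Fin k → ℚ) → combℚ c ≡ zeroV → ∀ i → c i ≡ 0ℚ
      signCoherent     : ∀ {β} → β ∈ Φ →
                         (∃ λ (c : Fin k → ℕ) → β ≡ combℕ c) ⊎
                         (∃ λ (c : Fin k → ℕ) → negV β ≡ combℕ c)

  Pos : V n → Set
  Pos β = β ∈ Φ × ∃ λ (c : Fin k → ℕ) → β ≡ combℕ c

  Neg : V n → Set
  Neg β = Pos (negV β)

  _⪯_ : V n → V n → Set
  α ⪯ β = ∃ λ (c : Fin k → ℕ) → β +v negV α ≡ combℕ c

  record IsHessenberg (𝔥 : V n → Set) : Set where
    field
      subsetPos   : ∀ {α} → 𝔥 α → Pos α
      complUpward : ∀ {α β} → Pos α → Pos β → α ⪯ β → ¬ 𝔥 α → ¬ 𝔥 β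

  -- Weyl group: elements are represented by words in reflections s_α
  -- (α ∈ Φ); a word α₁ ∷ … ∷ α_r acts as s_{α₁} ∘ … ∘ s_{α_r}.
  -- Two words denote the same element iff they act equally on V.

  Word : Set
  Word = List (V n)

  InW : Word → Set
  InW u = All (_∈ Φ) u

  act : Word → V n → V n
  act []      x = x
  act (α ∷ u) x = s α (act u x)

  actInv : Word → V n → V n
  actInv u = act (reverse u)

  _≈W_ : Word → Word → Set
  u ≈W w = ∀ x → act u x ≡ act w x

  sᵢ : Fin k → Word → Word
  sᵢ i u = lookup Δ i ∷ u

  simpleWord : List (Fin k) → Word
  simpleWord is = mapL (lookup Δ) is

  IsLength : Word → ℕ → Set
  IsLength w m =
    (∃ λ (is : List (Fin k)) → length is ≡ m × simpleWord is ≈W w) ×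
    (∀ (is : List (Fin k)) → simpleWord is ≈W w → m ≤ℕ length is)

  data _<B_ : Word → Word → Set where
    step  : ∀ {u w} α → Pos α → w ≈W (α ∷ u) → Neg (actInv w α) → u <B w
    trans : ∀ {u v w} → u <B v → v <B w → u <B w

  IsCover : Word → Word → Set
  IsCover v w = (∃ λ α → Pos α × v ≈W (α ∷ w)) ×
                (∃ λ m → IsLength w m × IsLength v (suc m))

  Edge : (V n → Set) → Word → Word → Set
  Edge 𝔥 u w = ∃ λ α → Pos α × w ≈W (α ∷ u) × 𝔥 (negV (actInv w α))

-- Write v = s_α w with α > 0. Since ℓ(v) > ℓ(w), the root w⁻¹α is positive, hence v⁻¹α = -w⁻¹α is
-- negative. If v⁻¹αᵢ were negative too, the exchange condition would give v = sᵢ u with ℓ(u) = ℓ(w);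
-- as v⁻¹α < 0, deleting one letter of a reduced word sᵢ u yields w. Deleting the leading sᵢ means
-- sᵢ w = v, and deleting a later letter writes w = sᵢ u' with ℓ(u') < ℓ(w); both are excluded.
-- So v⁻¹αᵢ > 0, which is the Bruhat relation v < sᵢ v, and exchange once more gives ℓ(sᵢ v) = ℓ(v) + 1.
-- The edges correspond under conjugation by sᵢ: the root α of w → v differs from αᵢ, so sᵢα is a
-- positive root with sᵢ v = s_{sᵢα} sᵢ w and (sᵢ v)⁻¹ sᵢα = v⁻¹α.
module Submission where

open import Defs
open import Algebra.Bundles using (CommutativeRing)
open import Data.Empty using (⊥; ⊥-elim)
open import Data.Fin using (Fin; zero; suc; punchIn) renaming (_≟_ to _≟ᶠ_)
open import Data.Fin.Properties using (punchInᵢ≢i)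
open import Data.List using (List; []; _∷_; _++_; reverse; length)
import Data.List.Properties as List
open import Data.List.Membership.Propositional using (_∈_)
open import Data.List.Relation.Unary.All using ([]; _∷_)
open import Data.Maybe using (Maybe; just; nothing)
open import Data.Nat using (ℕ; zero; suc; s≤s) renaming (_≤_ to _≤ℕ_)
import Data.Nat.Properties as ℕₚ
open import Data.Product using (_×_; _,_; ∃; proj₁; proj₂)
import Data.Product as Σ
open import Data.Rational using (ℚ; 0ℚ; 1ℚ; _+_; _*_; -_; _<_; _≤_; ≢-nonZero)
import Data.Rational.Properties as ℚ
open import Data.Sum using (_⊎_; fromInj₁)
import Data.Sum as Sum
open import Data.Vec using (Vec; []; _∷_; lookup; tabulate; zipWith)
import Data.Vec.Properties as Vec
open import Function using (_∘_)
open import Function.Bundles using (_⇔_; mk⇔)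
open import Relation.Nullary using (¬_; yes; no; contradiction)
open import Relation.Binary.PropositionalEquality
open import Algebra.Properties.Semiring.Sum (CommutativeRing.semiring ℚ.+-*-commutativeRing)
  using (sum; sum-cong-≗; ∑-comm; ∑-distrib-+; *-distribˡ-sum; sum-remove; sum-replicate-zero)
open import Tactic.RingSolver using (solve-∀)
open import Tactic.RingSolver.Core.AlmostCommutativeRing using (AlmostCommutativeRing; fromCommutativeRing)

ℚ-almostCommutativeRing : AlmostCommutativeRing _ _
ℚ-almostCommutativeRing = fromCommutativeRing ℚ.+-*-commutativeRing isZero
  where
  isZero : ∀ x → Maybe (0ℚ ≡ x)
  isZero x with 0ℚ ℚ.≟ x
  ... | yes 0≡x = just 0≡x
  ... | no _    = nothing

*-inv : ∀ p → p ≢ 0ℚ → p * inv p ≡ 1ℚ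
*-inv p p≢0 with p ℚ.≟ 0ℚ
... | yes p≡0  = contradiction p≡0 p≢0
... | no p≢0′ = ℚ.*-inverseʳ p {{≢-nonZero p≢0′}}

ℕtoℚ-nonNeg : ∀ a → 0ℚ ≤ ℕtoℚ a
ℕtoℚ-nonNeg a = ℚ.nonNegative⁻¹ (ℕtoℚ a) {{ℚ.normalize-nonNeg a 1}}

ℕtoℚ≡-ℕtoℚ⇒zero : ∀ a b → ℕtoℚ a ≡ - ℕtoℚ b → a ≡ 0
ℕtoℚ≡-ℕtoℚ⇒zero zero    b _     = refl
ℕtoℚ≡-ℕtoℚ⇒zero (suc a) b a≡-b = contradiction (ℚ.<-≤-trans 0<a a≤0) (ℚ.<-irrefl refl)
  where
  0<a : 0ℚ < ℕtoℚ (suc a)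
  0<a = ℚ.positive⁻¹ (ℕtoℚ (suc a)) {{ℚ.normalize-pos (suc a) 1}}
  a≤0 : ℕtoℚ (suc a) ≤ 0ℚ
  a≤0 = subst (_≤ 0ℚ) (sym a≡-b) (ℚ.neg-antimono-≤ (ℕtoℚ-nonNeg b))

0ℚ≢-1ℚ : 0ℚ ≢ - 1ℚ
0ℚ≢-1ℚ ()

δ : ∀ {k} → Fin k → Fin k → ℕ
δ i j with j ≟ᶠ i
... | yes _ = 1
... | no _  = 0

δ-diag : ∀ {k} (i : Fin k) → δ i i ≡ 1
δ-diag i with i ≟ᶠ i
... | yes _  = refl
... | no i≢i = contradiction refl i≢i

δ-off : ∀ {k} {i j : Fin k} → j ≢ i → δ i j ≡ 0
δ-off {i = i} {j} j≢i with j ≟ᶠ i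
... | yes j≡i = contradiction j≡i j≢i
... | no _    = refl

dot : ∀ {m} → (Fin m → ℚ) → (Fin m → ℚ) → ℚ
dot a t = sum (λ j → a j * t j)

module _ {m : ℕ} where

  dot-congˡ : ∀ {a b : Fin m → ℚ} t → (∀ j → a j ≡ b j) → dot a t ≡ dot b t
  dot-congˡ t a≗b = sum-cong-≗ (λ j → cong (_* t j) (a≗b j))

  dot-congʳ : ∀ a {t u : Fin m → ℚ} → (∀ j → t j ≡ u j) → dot a t ≡ dot a u
  dot-congʳ a t≗u = sum-cong-≗ (λ j → cong (a j *_) (t≗u j))

  dot-+ˡ : ∀ (a b t : Fin m → ℚ) → dot (λ j → a j + b j) t ≡ dot a t + dot b t
  dot-+ˡ a b t = trans (sum-cong-≗ (λ j → ℚ.*-distribʳ-+ (t j) (a j) (b j)))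
                       (∑-distrib-+ (λ j → a j * t j) (λ j → b j * t j))

  dot-*ˡ : ∀ c (a t : Fin m → ℚ) → dot (λ j → c * a j) t ≡ c * dot a t
  dot-*ˡ c a t = trans (sum-cong-≗ (λ j → ℚ.*-assoc c (a j) (t j)))
                       (sym (*-distribˡ-sum c (λ j → a j * t j)))

  dot-subˡ : ∀ (a b t : Fin m → ℚ) c → dot (λ j → a j + - (c * b j)) t ≡ dot a t + - (c * dot b t)
  dot-subˡ a b t c = begin
    dot (λ j → a j + - (c * b j)) t    ≡⟨ dot-congˡ t (λ j → cong (a j +_) (ℚ.neg-distribˡ-* c (b j))) ⟩
    dot (λ j → a j + - c * b j) t      ≡⟨ dot-+ˡ a (λ j → - c * b j) t ⟩
    dot a t + dot (λ j → - c * b j) t  ≡⟨ cong (dot a t +_) (dot-*ˡ (- c) b t) ⟩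
    dot a t + - c * dot b t            ≡⟨ cong (dot a t +_) (ℚ.neg-distribˡ-* c (dot b t)) ⟨
    dot a t + - (c * dot b t)          ∎
    where open ≡-Reasoning

  dot-negˡ : ∀ (a t : Fin m → ℚ) → dot (λ j → - a j) t ≡ - dot a t
  dot-negˡ a t = begin
    dot (λ j → - a j) t       ≡⟨ dot-congˡ t (λ j → neg-as-* (a j)) ⟩
    dot (λ j → - 1ℚ * a j) t  ≡⟨ dot-*ˡ (- 1ℚ) a t ⟩
    - 1ℚ * dot a t            ≡⟨ neg-as-* (dot a t) ⟨
    - dot a t                 ∎
    where
    open ≡-Reasoning
    neg-as-* : ∀ x → - x ≡ - 1ℚ * x
    neg-as-* = solve-∀ ℚ-almostCommutativeRing

dot-single : ∀ {m} (a t : Fin m → ℚ) i → (∀ j → j ≢ i → a j ≡ 0ℚ) → dot a t ≡ a i * t i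
dot-single {suc m} a t i a-supported = begin
  dot a t                                                     ≡⟨ sum-remove {i = i} (λ j → a j * t j) ⟩
  a i * t i + sum (λ j → a (punchIn i j) * t (punchIn i j))   ≡⟨ cong (a i * t i +_) (sum-cong-≗ vanish) ⟩
  a i * t i + sum {m} (λ _ → 0ℚ)                              ≡⟨ cong (a i * t i +_) (sum-replicate-zero m) ⟩
  a i * t i + 0ℚ                                              ≡⟨ ℚ.+-identityʳ (a i * t i) ⟩
  a i * t i                                                   ∎
  where
  open ≡-Reasoning
  vanish : ∀ j → a (punchIn i j) * t (punchIn i j) ≡ 0ℚ
  vanish j = trans (cong (_* t (punchIn i j)) (a-supported (punchIn i j) (punchInᵢ≢i i j)))
                   (ℚ.*-zeroˡ (t (punchIn i j)))

sumℚ≡sum : ∀ {m} (v : Vec ℚ m) → sumℚ v ≡ sum (lookup v)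
sumℚ≡sum []      = refl
sumℚ≡sum (x ∷ v) = cong (x +_) (sumℚ≡sum v)

sumℚ-zipWith-* : ∀ {m} (x y : Vec ℚ m) → sumℚ (zipWith _*_ x y) ≡ dot (lookup x) (lookup y)
sumℚ-zipWith-* x y = trans (sumℚ≡sum (zipWith _*_ x y)) (sum-cong-≗ (λ q → Vec.lookup-zipWith _*_ q x y))

module _ {n : ℕ} where

  V-ext : ∀ {x y : V n} → (∀ q → lookup x q ≡ lookup y q) → x ≡ y
  V-ext {x} {y} x≗y = begin
    x                    ≡⟨ Vec.tabulate∘lookup x ⟨
    tabulate (lookup x)  ≡⟨ Vec.tabulate-cong x≗y ⟩
    tabulate (lookup y)  ≡⟨ Vec.tabulate∘lookup y ⟩
    y                    ∎
    where open ≡-Reasoning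

  lookup-+v : ∀ (x y : V n) q → lookup (x +v y) q ≡ lookup x q + lookup y q
  lookup-+v x y q = Vec.lookup-zipWith _+_ q x y

  lookup-·v : ∀ c (x : V n) q → lookup (c ·v x) q ≡ c * lookup x q
  lookup-·v c x q = Vec.lookup-map q (c *_) x

  lookup-negV : ∀ (x : V n) q → lookup (negV x) q ≡ - lookup x q
  lookup-negV x q = Vec.lookup-map q -_ x

  lookup-zeroV : ∀ q → lookup (zeroV {n}) q ≡ 0ℚ
  lookup-zeroV q = Vec.lookup-replicate q 0ℚ

  lookup-sub : ∀ (x a : V n) c q → lookup (x +v negV (c ·v a)) q ≡ lookup x q + - (c * lookup a q)
  lookup-sub x a c q = trans (lookup-+v x (negV (c ·v a)) q)
                             (cong (lookup x q +_) (trans (lookup-negV (c ·v a) q)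
                                                          (cong -_ (lookup-·v c a q))))

  lookup-sumV : ∀ {m} (x : Fin m → V n) q → lookup (sumV (tabulate x)) q ≡ sum (λ j → lookup (x j) q)
  lookup-sumV {zero}  x q = lookup-zeroV q
  lookup-sumV {suc m} x q = trans (lookup-+v (x zero) (sumV (tabulate (λ j → x (suc j)))) q)
                                  (cong (lookup (x zero) q +_) (lookup-sumV (λ j → x (suc j)) q))

  negV-involutive : ∀ (x : V n) → negV (negV x) ≡ x
  negV-involutive x = V-ext λ q →
    trans (lookup-negV (negV x) q) (trans (cong -_ (lookup-negV x q)) (neg-neg (lookup x q)))
    where
    neg-neg : ∀ a → - - a ≡ a
    neg-neg = solve-∀ ℚ-almostCommutativeRing

  sub-self : ∀ (x : V n) → x +v negV (1ℚ ·v x) ≡ zeroV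
  sub-self x = V-ext λ q → trans (lookup-sub x x 1ℚ q) (trans (cancel (lookup x q)) (sym (lookup-zeroV q)))
    where
    cancel : ∀ a → a + - (1ℚ * a) ≡ 0ℚ
    cancel = solve-∀ ℚ-almostCommutativeRing

  ·v-identityˡ : ∀ (x : V n) → 1ℚ ·v x ≡ x
  ·v-identityˡ x = V-ext λ q → trans (lookup-·v 1ℚ x q) (ℚ.*-identityˡ (lookup x q))

module InnerProduct {n k : ℕ} (G : Vec (Vec ℚ n) n) (Φ : List (V n)) (Δ : Vec (V n) k) where
  open RS G Φ Δ hiding (trans)

  G·_ : V n → Fin n → ℚ
  (G· y) q = dot (lookup (lookup G q)) (lookup y)

  ⟨,⟩-as-dot : ∀ x y → ⟨ x , y ⟩ ≡ dot (lookup x) (G· y)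
  ⟨,⟩-as-dot x y = trans (sumℚ-zipWith-* x _) (dot-congʳ (lookup x) (λ q →
    trans (Vec.lookup-map q (λ row → sumℚ (zipWith _*_ row y)) G) (sumℚ-zipWith-* (lookup G q) y)))

  ⟨,⟩-subˡ : ∀ x a c y → ⟨ x +v negV (c ·v a) , y ⟩ ≡ ⟨ x , y ⟩ + - (c * ⟨ a , y ⟩)
  ⟨,⟩-subˡ x a c y = begin
    ⟨ x +v negV (c ·v a) , y ⟩                          ≡⟨ ⟨,⟩-as-dot (x +v negV (c ·v a)) y ⟩
    dot (lookup (x +v negV (c ·v a))) (G· y)           ≡⟨ dot-congˡ (G· y) (lookup-sub x a c) ⟩
    dot (λ q → lookup x q + - (c * lookup a q)) (G· y) ≡⟨ dot-subˡ (lookup x) (lookup a) (G· y) c ⟩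
    dot (lookup x) (G· y) + - (c * dot (lookup a) (G· y))
      ≡⟨ cong₂ (λ u v → u + - (c * v)) (⟨,⟩-as-dot x y) (⟨,⟩-as-dot a y) ⟨
    ⟨ x , y ⟩ + - (c * ⟨ a , y ⟩)                        ∎
    where open ≡-Reasoning

  ⟨,⟩-negˡ : ∀ x y → ⟨ negV x , y ⟩ ≡ - ⟨ x , y ⟩
  ⟨,⟩-negˡ x y = begin
    ⟨ negV x , y ⟩                 ≡⟨ ⟨,⟩-as-dot (negV x) y ⟩
    dot (lookup (negV x)) (G· y)   ≡⟨ dot-congˡ (G· y) (lookup-negV x) ⟩
    dot (λ q → - lookup x q) (G· y) ≡⟨ dot-negˡ (lookup x) (G· y) ⟩
    - dot (lookup x) (G· y)        ≡⟨ cong -_ (⟨,⟩-as-dot x y) ⟨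
    - ⟨ x , y ⟩                    ∎
    where open ≡-Reasoning

  ⟨,⟩-sym : (∀ i j → lookup (lookup G i) j ≡ lookup (lookup G j) i) → ∀ x y → ⟨ x , y ⟩ ≡ ⟨ y , x ⟩
  ⟨,⟩-sym G-sym x y = begin
    ⟨ x , y ⟩                                      ≡⟨ ⟨,⟩-as-dot x y ⟩
    sum (λ q → x′ q * sum (λ r → g q r * y′ r))    ≡⟨ sum-cong-≗ (λ q → *-distribˡ-sum {n} (x′ q) (g′ q)) ⟩
    sum (λ q → sum (λ r → x′ q * (g q r * y′ r)))  ≡⟨ ∑-comm (λ q r → x′ q * (g q r * y′ r)) ⟩
    sum (λ r → sum (λ q → x′ q * (g q r * y′ r)))  ≡⟨ sum-cong-≗ (λ r → sum-cong-≗ (λ q → swap q r)) ⟩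
    sum (λ r → sum (λ q → y′ r * (g r q * x′ q)))  ≡⟨ sum-cong-≗ (λ r → *-distribˡ-sum {n} (y′ r) (g″ r)) ⟨
    sum (λ r → y′ r * sum (λ q → g r q * x′ q))    ≡⟨ ⟨,⟩-as-dot y x ⟨
    ⟨ y , x ⟩                                      ∎
    where
    open ≡-Reasoning
    x′ y′ : Fin n → ℚ
    x′ = lookup x
    y′ = lookup y
    g : Fin n → Fin n → ℚ
    g q r = lookup (lookup G q) r
    g′ g″ : Fin n → Fin n → ℚ
    g′ q r = g q r * y′ r
    g″ r q = g r q * x′ q
    reorder : ∀ a b c → a * (b * c) ≡ c * (b * a)
    reorder = solve-∀ ℚ-almostCommutativeRing
    swap : ∀ q r → x′ q * (g q r * y′ r) ≡ y′ r * (g r q * x′ q)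
    swap q r = trans (cong (λ b → x′ q * (b * y′ r)) (G-sym q r)) (reorder (x′ q) (g r q) (y′ r))

module Reflection {n k : ℕ} (G : Vec (Vec ℚ n) n) (Φ : List (V n)) (Δ : Vec (V n) k)
                  (G-sym : ∀ i j → lookup (lookup G i) j ≡ lookup (lookup G j) i) where
  open RS G Φ Δ hiding (trans)
  open InnerProduct G Φ Δ

  -- Pairing with the coroot 2α/⟨α,α⟩: s α x is by definition x +v negV (⟨ x , α ∨⟩ ·v α).
  ⟨_,_∨⟩ : V n → V n → ℚ
  ⟨ x , α ∨⟩ = two * ⟨ x , α ⟩ * inv ⟨ α , α ⟩

  s-negV : ∀ α x → s α (negV x) ≡ negV (s α x)
  s-negV α x = V-ext λ q → begin
    lookup (s α (negV x)) q                                ≡⟨ lookup-sub (negV x) α ⟨ negV x , α ∨⟩ q ⟩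
    lookup (negV x) q + - (⟨ negV x , α ∨⟩ * lookup α q)
      ≡⟨ cong₂ (λ u t → u + - (two * t * i * lookup α q)) (lookup-negV x q) (⟨,⟩-negˡ x α) ⟩
    - lookup x q + - (two * - ⟨ x , α ⟩ * i * lookup α q)  ≡⟨ distrib (lookup x q) ⟨ x , α ⟩ i (lookup α q) ⟩
    - (lookup x q + - (⟨ x , α ∨⟩ * lookup α q))           ≡⟨ cong -_ (lookup-sub x α ⟨ x , α ∨⟩ q) ⟨
    - lookup (s α x) q                                     ≡⟨ lookup-negV (s α x) q ⟨
    lookup (negV (s α x)) q                                ∎
    where
    open ≡-Reasoning
    i = inv ⟨ α , α ⟩
    distrib : ∀ x t i a → - x + - ((1ℚ + 1ℚ) * - t * i * a) ≡ - (x + - ((1ℚ + 1ℚ) * t * i * a))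
    distrib = solve-∀ ℚ-almostCommutativeRing

  s-sub : ∀ β u a c → s β (u +v negV (c ·v a)) ≡ s β u +v negV (c ·v s β a)
  s-sub β u a c = V-ext λ q → begin
    lookup (s β (u +v negV (c ·v a))) q
      ≡⟨ lookup-sub (u +v negV (c ·v a)) β ⟨ u +v negV (c ·v a) , β ∨⟩ q ⟩
    lookup (u +v negV (c ·v a)) q + - (two * ⟨ u +v negV (c ·v a) , β ⟩ * i * lookup β q)
      ≡⟨ cong₂ (λ v t → v + - (two * t * i * lookup β q)) (lookup-sub u a c q) (⟨,⟩-subˡ u a c β) ⟩
    lookup u q + - (c * lookup a q) + - (two * (⟨ u , β ⟩ + - (c * ⟨ a , β ⟩)) * i * lookup β q)
      ≡⟨ regroup (lookup u q) (lookup a q) c ⟨ u , β ⟩ ⟨ a , β ⟩ i (lookup β q) ⟩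
    lookup u q + - (⟨ u , β ∨⟩ * lookup β q) + - (c * (lookup a q + - (⟨ a , β ∨⟩ * lookup β q)))
      ≡⟨ cong₂ (λ v w → v + - (c * w)) (lookup-sub u β ⟨ u , β ∨⟩ q) (lookup-sub a β ⟨ a , β ∨⟩ q) ⟨
    lookup (s β u) q + - (c * lookup (s β a) q)
      ≡⟨ lookup-sub (s β u) (s β a) c q ⟨
    lookup (s β u +v negV (c ·v s β a)) q
      ∎
    where
    open ≡-Reasoning
    i = inv ⟨ β , β ⟩
    regroup : ∀ u a c tu ta i b →
      u + - (c * a) + - ((1ℚ + 1ℚ) * (tu + - (c * ta)) * i * b)
        ≡ u + - ((1ℚ + 1ℚ) * tu * i * b) + - (c * (a + - ((1ℚ + 1ℚ) * ta * i * b)))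
    regroup = solve-∀ ℚ-almostCommutativeRing

  module _ (α : V n) (α≢0 : ⟨ α , α ⟩ ≢ 0ℚ) where

    coroot-self : ⟨ α , α ∨⟩ ≡ two
    coroot-self = begin
      two * ⟨ α , α ⟩ * inv ⟨ α , α ⟩    ≡⟨ ℚ.*-assoc two ⟨ α , α ⟩ (inv ⟨ α , α ⟩) ⟩
      two * (⟨ α , α ⟩ * inv ⟨ α , α ⟩)  ≡⟨ cong (two *_) (*-inv ⟨ α , α ⟩ α≢0) ⟩
      two * 1ℚ                           ≡⟨ ℚ.*-identityʳ two ⟩
      two                                ∎
      where open ≡-Reasoning

    ⟨s,⟩ : ∀ x → ⟨ s α x , α ⟩ ≡ - ⟨ x , α ⟩
    ⟨s,⟩ x = begin
      ⟨ s α x , α ⟩                                ≡⟨ ⟨,⟩-subˡ x α ⟨ x , α ∨⟩ α ⟩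
      ⟨ x , α ⟩ + - (two * ⟨ x , α ⟩ * inv A * A)  ≡⟨ regroup ⟨ x , α ⟩ (inv A) A ⟩
      ⟨ x , α ⟩ + - (two * ⟨ x , α ⟩ * (A * inv A))
        ≡⟨ cong (λ u → ⟨ x , α ⟩ + - (two * ⟨ x , α ⟩ * u)) (*-inv A α≢0) ⟩
      ⟨ x , α ⟩ + - (two * ⟨ x , α ⟩ * 1ℚ)         ≡⟨ cancel ⟨ x , α ⟩ ⟩
      - ⟨ x , α ⟩                                  ∎
      where
      open ≡-Reasoning
      A = ⟨ α , α ⟩
      regroup : ∀ t i a → t + - ((1ℚ + 1ℚ) * t * i * a) ≡ t + - ((1ℚ + 1ℚ) * t * (a * i))
      regroup = solve-∀ ℚ-almostCommutativeRing
      cancel : ∀ t → t + - ((1ℚ + 1ℚ) * t * 1ℚ) ≡ - t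
      cancel = solve-∀ ℚ-almostCommutativeRing

    coroot-s : ∀ x → ⟨ s α x , α ∨⟩ ≡ - ⟨ x , α ∨⟩
    coroot-s x = trans (cong (λ t → two * t * inv ⟨ α , α ⟩) (⟨s,⟩ x)) (neg-middle ⟨ x , α ⟩ (inv ⟨ α , α ⟩))
      where
      neg-middle : ∀ t i → (1ℚ + 1ℚ) * - t * i ≡ - ((1ℚ + 1ℚ) * t * i)
      neg-middle = solve-∀ ℚ-almostCommutativeRing

    s-involutive : ∀ x → s α (s α x) ≡ x
    s-involutive x = V-ext λ q → begin
      lookup (s α (s α x)) q                                  ≡⟨ lookup-sub (s α x) α ⟨ s α x , α ∨⟩ q ⟩
      lookup (s α x) q + - (⟨ s α x , α ∨⟩ * lookup α q)
        ≡⟨ cong₂ (λ u c → u + - (c * lookup α q)) (lookup-sub x α c q) (coroot-s x) ⟩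
      lookup x q + - (c * lookup α q) + - (- c * lookup α q)  ≡⟨ cancel (lookup x q) c (lookup α q) ⟩
      lookup x q                                              ∎
      where
      open ≡-Reasoning
      c = ⟨ x , α ∨⟩
      cancel : ∀ x c a → x + - (c * a) + - (- c * a) ≡ x
      cancel = solve-∀ ℚ-almostCommutativeRing

    s-self : s α α ≡ negV α
    s-self = V-ext λ q → begin
      lookup (s α α) q                          ≡⟨ lookup-sub α α ⟨ α , α ∨⟩ q ⟩
      lookup α q + - (⟨ α , α ∨⟩ * lookup α q)  ≡⟨ cong (λ c → lookup α q + - (c * lookup α q)) coroot-self ⟩
      lookup α q + - (two * lookup α q)         ≡⟨ cancel (lookup α q) ⟩
      - lookup α q                              ≡⟨ lookup-negV α q ⟨
      lookup (negV α) q                         ∎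
      where
      open ≡-Reasoning
      cancel : ∀ a → a + - ((1ℚ + 1ℚ) * a) ≡ - a
      cancel = solve-∀ ℚ-almostCommutativeRing

    s-isometry : ∀ x y → ⟨ s α x , s α y ⟩ ≡ ⟨ x , y ⟩
    s-isometry x y = begin
      ⟨ s α x , s α y ⟩
        ≡⟨ ⟨,⟩-subˡ x α (two * tx * i) (s α y) ⟩
      ⟨ x , s α y ⟩ + - (two * tx * i * ⟨ α , s α y ⟩)
        ≡⟨ cong₂ (λ u v → u + - (two * tx * i * v)) (⟨,⟩-sym G-sym x (s α y)) (⟨,⟩-sym G-sym α (s α y)) ⟩
      ⟨ s α y , x ⟩ + - (two * tx * i * ⟨ s α y , α ⟩)
        ≡⟨ cong₂ (λ u v → u + - (two * tx * i * v)) (⟨,⟩-subˡ y α (two * ty * i) x) (⟨s,⟩ y) ⟩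
      ⟨ y , x ⟩ + - (two * ty * i * ⟨ α , x ⟩) + - (two * tx * i * - ty)
        ≡⟨ cong₂ (λ u v → u + - (two * ty * i * v) + - (two * tx * i * - ty))
                 (⟨,⟩-sym G-sym y x) (⟨,⟩-sym G-sym α x) ⟩
      ⟨ x , y ⟩ + - (two * ty * i * tx) + - (two * tx * i * - ty)
        ≡⟨ cancel ⟨ x , y ⟩ tx ty i ⟩
      ⟨ x , y ⟩
        ∎
      where
      open ≡-Reasoning
      tx = ⟨ x , α ⟩
      ty = ⟨ y , α ⟩
      i = inv ⟨ α , α ⟩
      cancel : ∀ p tx ty i → p + - ((1ℚ + 1ℚ) * ty * i * tx) + - ((1ℚ + 1ℚ) * tx * i * - ty) ≡ p
      cancel = solve-∀ ℚ-almostCommutativeRing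

  s-conj : ∀ α β → ⟨ α , α ⟩ ≢ 0ℚ → ⟨ β , β ⟩ ≢ 0ℚ → ∀ x → s (s β α) x ≡ s β (s α (s β x))
  s-conj α β α≢0 β≢0 x = begin
    x +v negV (⟨ x , s β α ∨⟩ ·v s β α)  ≡⟨ cong (λ c → x +v negV (c ·v s β α)) coroot-conj ⟩
    x +v negV (c ·v s β α)              ≡⟨ cong (λ y → y +v negV (c ·v s β α)) (s-involutive β β≢0 x) ⟨
    s β (s β x) +v negV (c ·v s β α)    ≡⟨ s-sub β (s β x) α c ⟨
    s β (s α (s β x))                   ∎
    where
    open ≡-Reasoning
    c = ⟨ s β x , α ∨⟩
    coroot-conj : ⟨ x , s β α ∨⟩ ≡ c
    coroot-conj = cong₂ (λ t A → two * t * inv A)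
      (trans (cong (λ y → ⟨ y , s β α ⟩) (sym (s-involutive β β≢0 x))) (s-isometry β β≢0 (s β x) α))
      (s-isometry β β≢0 α α)

module RootSystem {n k : ℕ} (G : Vec (Vec ℚ n) n) (Φ : List (V n)) (Δ : Vec (V n) k)
                  (R : RS.IsCrystallographicRootSystemWithBase G Φ Δ) where
  open RS G Φ Δ hiding (trans)
  open IsCrystallographicRootSystemWithBase R
  open Reflection G Φ Δ (IsInnerProduct.symmetric innerProduct) public

  root-nonisotropic : ∀ {α} → α ∈ Φ → ⟨ α , α ⟩ ≢ 0ℚ
  root-nonisotropic {α} α∈Φ α·α≡0 =
    ℚ.<-irrefl (sym α·α≡0) (IsInnerProduct.posDefinite innerProduct α (nonzero α∈Φ))

  negV-root : ∀ {α} → α ∈ Φ → negV α ∈ Φ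
  negV-root {α} α∈Φ = subst (_∈ Φ) (s-self α (root-nonisotropic α∈Φ)) (reflectionClosed α∈Φ α∈Φ)

  Δ-coordinate : Fin n → Fin k → ℚ
  Δ-coordinate q j = lookup (lookup Δ j) q

  lookup-combℚ : ∀ f q → lookup (combℚ f) q ≡ dot f (Δ-coordinate q)
  lookup-combℚ f q = trans (lookup-sumV (λ j → f j ·v lookup Δ j) q)
                           (sum-cong-≗ (λ j → lookup-·v (f j) (lookup Δ j) q))

  combℚ-sub : ∀ f g c → combℚ f +v negV (c ·v combℚ g) ≡ combℚ (λ j → f j + - (c * g j))
  combℚ-sub f g c = V-ext λ q → begin
    lookup (combℚ f +v negV (c ·v combℚ g)) q        ≡⟨ lookup-sub (combℚ f) (combℚ g) c q ⟩
    lookup (combℚ f) q + - (c * lookup (combℚ g) q)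
      ≡⟨ cong₂ (λ u v → u + - (c * v)) (lookup-combℚ f q) (lookup-combℚ g q) ⟩
    dot f (Δ-coordinate q) + - (c * dot g (Δ-coordinate q))  ≡⟨ dot-subˡ f g (Δ-coordinate q) c ⟨
    dot (λ j → f j + - (c * g j)) (Δ-coordinate q)           ≡⟨ lookup-combℚ (λ j → f j + - (c * g j)) q ⟨
    lookup (combℚ (λ j → f j + - (c * g j))) q               ∎
    where open ≡-Reasoning

  combℚ-negV : ∀ f → negV (combℚ f) ≡ combℚ (λ j → - f j)
  combℚ-negV f = V-ext λ q → begin
    lookup (negV (combℚ f)) q             ≡⟨ lookup-negV (combℚ f) q ⟩
    - lookup (combℚ f) q                  ≡⟨ cong -_ (lookup-combℚ f q) ⟩
    - dot f (Δ-coordinate q)              ≡⟨ dot-negˡ f (Δ-coordinate q) ⟨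
    dot (λ j → - f j) (Δ-coordinate q)    ≡⟨ lookup-combℚ (λ j → - f j) q ⟨
    lookup (combℚ (λ j → - f j)) q        ∎
    where open ≡-Reasoning

  combℚ-single : ∀ f i → (∀ j → j ≢ i → f j ≡ 0ℚ) → combℚ f ≡ f i ·v lookup Δ i
  combℚ-single f i f-supported = V-ext λ q →
    trans (lookup-combℚ f q)
          (trans (dot-single f (Δ-coordinate q) i f-supported) (sym (lookup-·v (f i) (lookup Δ i) q)))

  combℚ-zero : ∀ f → (∀ j → f j ≡ 0ℚ) → combℚ f ≡ zeroV
  combℚ-zero f f≡0 = V-ext λ q → begin
    lookup (combℚ f) q         ≡⟨ lookup-combℚ f q ⟩
    dot f (Δ-coordinate q)     ≡⟨ sum-cong-≗ (λ j → trans (cong (_* Δ-coordinate q j) (f≡0 j))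
                                                         (ℚ.*-zeroˡ (Δ-coordinate q j))) ⟩
    sum {k} (λ _ → 0ℚ)         ≡⟨ sum-replicate-zero k ⟩
    0ℚ                         ≡⟨ lookup-zeroV q ⟨
    lookup zeroV q             ∎
    where open ≡-Reasoning

  combℚ-injective : ∀ {f g} → combℚ f ≡ combℚ g → ∀ j → f j ≡ g j
  combℚ-injective {f} {g} f≡g j = sub≡0⇒≡ (f j) (g j) (linIndependent (λ j → f j + - (1ℚ * g j)) f-g≡0 j)
    where
    f-g≡0 : combℚ (λ j → f j + - (1ℚ * g j)) ≡ zeroV
    f-g≡0 = begin
      combℚ (λ j → f j + - (1ℚ * g j))  ≡⟨ combℚ-sub f g 1ℚ ⟨
      combℚ f +v negV (1ℚ ·v combℚ g)   ≡⟨ cong (λ x → x +v negV (1ℚ ·v combℚ g)) f≡g ⟩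
      combℚ g +v negV (1ℚ ·v combℚ g)   ≡⟨ sub-self (combℚ g) ⟩
      zeroV                             ∎
      where open ≡-Reasoning
    sub≡0⇒≡ : ∀ a b → a + - (1ℚ * b) ≡ 0ℚ → a ≡ b
    sub≡0⇒≡ a b a-b≡0 = trans (regroup a b) (trans (cong (_+ b) a-b≡0) (ℚ.+-identityˡ b))
      where
      regroup : ∀ a b → a ≡ a + - (1ℚ * b) + b
      regroup = solve-∀ ℚ-almostCommutativeRing

  Pos⊎Neg : ∀ {γ} → γ ∈ Φ → Pos γ ⊎ Neg γ
  Pos⊎Neg γ∈Φ = Sum.map (γ∈Φ ,_) (negV-root γ∈Φ ,_) (signCoherent γ∈Φ)

  Pos⇒¬Neg : ∀ {γ} → Pos γ → ¬ Neg γ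
  Pos⇒¬Neg {γ} (γ∈Φ , e , γ≡e) (_ , d , -γ≡d) = nonzero γ∈Φ (trans γ≡e (combℚ-zero _ e≡0))
    where
    e≡-d : ∀ j → ℕtoℚ (e j) ≡ - ℕtoℚ (d j)
    e≡-d = combℚ-injective (begin
      combℕ e                     ≡⟨ γ≡e ⟨
      γ                           ≡⟨ negV-involutive γ ⟨
      negV (negV γ)               ≡⟨ cong negV -γ≡d ⟩
      negV (combℕ d)              ≡⟨ combℚ-negV (λ j → ℕtoℚ (d j)) ⟩
      combℚ (λ j → - ℕtoℚ (d j))  ∎)
      where open ≡-Reasoning
    e≡0 : ∀ j → ℕtoℚ (e j) ≡ 0ℚ
    e≡0 j = cong ℕtoℚ (ℕtoℚ≡-ℕtoℚ⇒zero (e j) (d j) (e≡-d j))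

  Pos⇒Neg-negV : ∀ {γ} → Pos γ → Neg (negV γ)
  Pos⇒Neg-negV {γ} = subst Pos (sym (negV-involutive γ))

  simple-Pos : ∀ i → Pos (lookup Δ i)
  simple-Pos i = simpleRoots i , δ i , sym (begin
    combℕ (δ i)                 ≡⟨ combℚ-single (λ j → ℕtoℚ (δ i j)) i (λ j j≢i → cong ℕtoℚ (δ-off j≢i)) ⟩
    ℕtoℚ (δ i i) ·v lookup Δ i  ≡⟨ cong (λ a → ℕtoℚ a ·v lookup Δ i) (δ-diag i) ⟩
    1ℚ ·v lookup Δ i            ≡⟨ ·v-identityˡ (lookup Δ i) ⟩
    lookup Δ i                  ∎)
    where open ≡-Reasoning

  -- The coefficients of β and of s αᵢ β = β - c αᵢ agree off i; if s αᵢ β were negative they would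
  -- vanish there, so β would be a multiple of αᵢ and hence αᵢ itself by reducedness.
  s-simple-¬Neg : ∀ i {β} → Pos β → β ≢ lookup Δ i → ¬ Neg (s (lookup Δ i) β)
  s-simple-¬Neg i {β} (β∈Φ , e , β≡e) β≢αᵢ (_ , d , -sβ≡d) = β≢αᵢ β≡αᵢ
    where
    αᵢ : V n
    αᵢ = lookup Δ i
    c : ℚ
    c = ⟨ β , αᵢ ∨⟩
    E : Fin k → ℚ
    E j = ℕtoℚ (e j)
    e-cδ≡-d : ∀ j → E j + - (c * ℕtoℚ (δ i j)) ≡ - ℕtoℚ (d j)
    e-cδ≡-d = combℚ-injective (begin
      combℚ (λ j → E j + - (c * ℕtoℚ (δ i j)))  ≡⟨ combℚ-sub E (λ j → ℕtoℚ (δ i j)) c ⟨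
      combℚ E +v negV (c ·v combℕ (δ i))
        ≡⟨ cong₂ (λ x y → x +v negV (c ·v y)) β≡e (proj₂ (proj₂ (simple-Pos i))) ⟨
      s αᵢ β                                     ≡⟨ negV-involutive (s αᵢ β) ⟨
      negV (negV (s αᵢ β))                       ≡⟨ cong negV -sβ≡d ⟩
      negV (combℕ d)                             ≡⟨ combℚ-negV (λ j → ℕtoℚ (d j)) ⟩
      combℚ (λ j → - ℕtoℚ (d j))                 ∎)
      where open ≡-Reasoning
    e-off : ∀ j → j ≢ i → E j ≡ 0ℚ
    e-off j j≢i = cong ℕtoℚ (ℕtoℚ≡-ℕtoℚ⇒zero (e j) (d j) (begin
      E j                         ≡⟨ drop-zero (E j) c ⟨
      E j + - (c * 0ℚ)            ≡⟨ cong (λ a → E j + - (c * ℕtoℚ a)) (δ-off j≢i) ⟨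
      E j + - (c * ℕtoℚ (δ i j))  ≡⟨ e-cδ≡-d j ⟩
      - ℕtoℚ (d j)                ∎))
      where
      open ≡-Reasoning
      drop-zero : ∀ x c → x + - (c * 0ℚ) ≡ x
      drop-zero = solve-∀ ℚ-almostCommutativeRing
    β≡eᵢαᵢ : β ≡ E i ·v αᵢ
    β≡eᵢαᵢ = trans β≡e (combℚ-single E i e-off)
    eᵢ≢-1 : E i ≢ - 1ℚ
    eᵢ≢-1 eᵢ≡-1 = 0ℚ≢-1ℚ (subst (λ a → ℕtoℚ a ≡ - 1ℚ) (ℕtoℚ≡-ℕtoℚ⇒zero (e i) 1 eᵢ≡-1) eᵢ≡-1)
    eᵢ≡1 : E i ≡ 1ℚ
    eᵢ≡1 = fromInj₁ (⊥-elim ∘ eᵢ≢-1) (reduced (E i) (simpleRoots i) (subst (_∈ Φ) β≡eᵢαᵢ β∈Φ))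
    β≡αᵢ : β ≡ αᵢ
    β≡αᵢ = trans β≡eᵢαᵢ (trans (cong (_·v αᵢ) eᵢ≡1) (·v-identityˡ αᵢ))

  s-simple-Pos : ∀ i {β} → Pos β → β ≢ lookup Δ i → Pos (s (lookup Δ i) β)
  s-simple-Pos i β⁺ β≢αᵢ =
    fromInj₁ (⊥-elim ∘ s-simple-¬Neg i β⁺ β≢αᵢ) (Pos⊎Neg (reflectionClosed (simpleRoots i) (proj₁ β⁺)))

data OneDeletion {A : Set} : List A → List A → Set where
  here  : ∀ {x xs} → OneDeletion (x ∷ xs) xs
  there : ∀ {x xs ys} → OneDeletion xs ys → OneDeletion (x ∷ xs) (x ∷ ys)

OneDeletion-length : ∀ {A : Set} {xs ys : List A} → OneDeletion xs ys → length xs ≡ suc (length ys)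
OneDeletion-length here        = refl
OneDeletion-length (there del) = cong suc (OneDeletion-length del)

module WeylGroup {n k : ℕ} (G : Vec (Vec ℚ n) n) (Φ : List (V n)) (Δ : Vec (V n) k)
                 (R : RS.IsCrystallographicRootSystemWithBase G Φ Δ) where
  open RS G Φ Δ hiding (trans)
  open IsCrystallographicRootSystemWithBase R using (reflectionClosed; simpleRoots)
  open RootSystem G Φ Δ R public

  -- IsLength x m unfolds to HasWordOfLength x m × LengthAtLeast x m.
  HasWordOfLength : Word → ℕ → Set
  HasWordOfLength x m = ∃ λ is → length is ≡ m × simpleWord is ≈W x

  LengthAtLeast : Word → ℕ → Set
  LengthAtLeast x m = ∀ is → simpleWord is ≈W x → m ≤ℕ length is

  LengthAtLeast-cong : ∀ u w {m} → u ≈W w → LengthAtLeast u m → LengthAtLeast w m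
  LengthAtLeast-cong u w u≈w u≥m is is≈w = u≥m is (λ x → trans (is≈w x) (sym (u≈w x)))

  act-++ : ∀ u w x → act (u ++ w) x ≡ act u (act w x)
  act-++ []      w x = refl
  act-++ (α ∷ u) w x = cong (s α) (act-++ u w x)

  actInv-∷ : ∀ α u x → actInv (α ∷ u) x ≡ actInv u (s α x)
  actInv-∷ α u x = trans (cong (λ w → act w x) (List.unfold-reverse α u)) (act-++ (reverse u) (α ∷ []) x)

  act∘actInv : ∀ {u} → InW u → ∀ x → act u (actInv u x) ≡ x
  act∘actInv []                   x = refl
  act∘actInv {α ∷ u} (α∈Φ ∷ u∈W) x = begin
    s α (act u (actInv (α ∷ u) x))  ≡⟨ cong (λ y → s α (act u y)) (actInv-∷ α u x) ⟩
    s α (act u (actInv u (s α x)))  ≡⟨ cong (s α) (act∘actInv u∈W (s α x)) ⟩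
    s α (s α x)                     ≡⟨ s-involutive α (root-nonisotropic α∈Φ) x ⟩
    x                               ∎
    where open ≡-Reasoning

  actInv∘act : ∀ {u} → InW u → ∀ x → actInv u (act u x) ≡ x
  actInv∘act []                   x = refl
  actInv∘act {α ∷ u} (α∈Φ ∷ u∈W) x = begin
    actInv (α ∷ u) (s α (act u x))  ≡⟨ actInv-∷ α u (s α (act u x)) ⟩
    actInv u (s α (s α (act u x)))  ≡⟨ cong (actInv u) (s-involutive α (root-nonisotropic α∈Φ) (act u x)) ⟩
    actInv u (act u x)              ≡⟨ actInv∘act u∈W x ⟩
    x                               ∎
    where open ≡-Reasoning

  actInv-cong : ∀ {u w} → InW u → InW w → u ≈W w → ∀ x → actInv u x ≡ actInv w x
  actInv-cong {u} {w} u∈W w∈W u≈w x = begin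
    actInv u x                     ≡⟨ cong (actInv u) (act∘actInv w∈W x) ⟨
    actInv u (act w (actInv w x))  ≡⟨ cong (actInv u) (u≈w (actInv w x)) ⟨
    actInv u (act u (actInv w x))  ≡⟨ actInv∘act u∈W (actInv w x) ⟩
    actInv w x                     ∎
    where open ≡-Reasoning

  actInv-root : ∀ {u} → InW u → ∀ {γ} → γ ∈ Φ → actInv u γ ∈ Φ
  actInv-root []                        γ∈Φ = γ∈Φ
  actInv-root {α ∷ u} (α∈Φ ∷ u∈W) {γ} γ∈Φ =
    subst (_∈ Φ) (sym (actInv-∷ α u γ)) (actInv-root u∈W (reflectionClosed α∈Φ γ∈Φ))

  act-negV : ∀ u x → act u (negV x) ≡ negV (act u x)
  act-negV []      x = refl
  act-negV (α ∷ u) x = trans (cong (s α) (act-negV u x)) (s-negV α (act u x))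

  actInv-reflecting-root : ∀ {α} → α ∈ Φ → ∀ u → actInv (α ∷ u) α ≡ negV (actInv u α)
  actInv-reflecting-root {α} α∈Φ u = begin
    actInv (α ∷ u) α   ≡⟨ actInv-∷ α u α ⟩
    actInv u (s α α)   ≡⟨ cong (actInv u) (s-self α (root-nonisotropic α∈Φ)) ⟩
    actInv u (negV α)  ≡⟨ act-negV (reverse u) α ⟩
    negV (actInv u α)  ∎
    where open ≡-Reasoning

  InW-simpleWord : ∀ is → InW (simpleWord is)
  InW-simpleWord []       = []
  InW-simpleWord (i ∷ is) = simpleRoots i ∷ InW-simpleWord is

  ∷-swap : ∀ {α} u w → α ∈ Φ → (α ∷ u) ≈W w → (α ∷ w) ≈W u
  ∷-swap {α} u w α∈Φ αu≈w x =
    trans (cong (s α) (sym (αu≈w x))) (s-involutive α (root-nonisotropic α∈Φ) (act u x))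

  sᵢ-involutive : ∀ i u → sᵢ i (sᵢ i u) ≈W u
  sᵢ-involutive i u x = s-involutive (lookup Δ i) (root-nonisotropic (simpleRoots i)) (act u x)

  sᵢ-injective : ∀ i u w → sᵢ i u ≈W sᵢ i w → u ≈W w
  sᵢ-injective i u w siu≈siw x = begin
    act u x                ≡⟨ sᵢ-involutive i u x ⟨
    act (sᵢ i (sᵢ i u)) x  ≡⟨ cong (s (lookup Δ i)) (siu≈siw x) ⟩
    act (sᵢ i (sᵢ i w)) x  ≡⟨ sᵢ-involutive i w x ⟩
    act w x                ∎
    where open ≡-Reasoning

  exchange : ∀ is {γ} → Pos γ → Neg (actInv (simpleWord is) γ) →
             ∃ λ js → OneDeletion is js × (γ ∷ simpleWord is) ≈W simpleWord js
  exchange []       γ⁺ γ⁻ = contradiction γ⁻ (Pos⇒¬Neg γ⁺)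
  exchange (j ∷ is) {γ} γ⁺ w⁻¹γ⁻ with Vec.≡-dec ℚ._≟_ γ (lookup Δ j)
  ... | yes refl = is , here , sᵢ-involutive j (simpleWord is)
  ... | no γ≢αⱼ  = prepend (exchange is (s-simple-Pos j γ⁺ γ≢αⱼ) is⁻¹sⱼγ⁻)
    where
    αⱼ : V n
    αⱼ = lookup Δ j
    αⱼ≢0 : ⟨ αⱼ , αⱼ ⟩ ≢ 0ℚ
    αⱼ≢0 = root-nonisotropic (simpleRoots j)
    u : V n → V n
    u = act (simpleWord is)
    is⁻¹sⱼγ⁻ : Neg (actInv (simpleWord is) (s αⱼ γ))
    is⁻¹sⱼγ⁻ = subst Neg (actInv-∷ αⱼ (simpleWord is) γ) w⁻¹γ⁻
    prepend : (∃ λ js → OneDeletion is js × (s αⱼ γ ∷ simpleWord is) ≈W simpleWord js) →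
              ∃ λ js → OneDeletion (j ∷ is) js × (γ ∷ αⱼ ∷ simpleWord is) ≈W simpleWord js
    prepend (js , is▹js , sⱼγ-is≈js) = j ∷ js , there is▹js , λ x → begin
      s γ (s αⱼ (u x))                ≡⟨ s-involutive αⱼ αⱼ≢0 (s γ (s αⱼ (u x))) ⟨
      s αⱼ (s αⱼ (s γ (s αⱼ (u x))))  ≡⟨ cong (s αⱼ) (s-conj γ αⱼ (root-nonisotropic (proj₁ γ⁺)) αⱼ≢0 (u x)) ⟨
      s αⱼ (s (s αⱼ γ) (u x))         ≡⟨ cong (s αⱼ) (sⱼγ-is≈js x) ⟩
      s αⱼ (act (simpleWord js) x)    ∎
      where open ≡-Reasoning

  exchange-≈ : ∀ is {x γ} → InW x → simpleWord is ≈W x → Pos γ → Neg (actInv x γ) →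
               ∃ λ js → OneDeletion is js × (γ ∷ x) ≈W simpleWord js
  exchange-≈ is {γ = γ} x∈W is≈x γ⁺ x⁻¹γ⁻ =
    Σ.map₂ (Σ.map₂ λ γis≈js y → trans (cong (s γ) (sym (is≈x y))) (γis≈js y)) (exchange is γ⁺ is⁻¹γ⁻)
    where
    is⁻¹γ⁻ : Neg (actInv (simpleWord is) γ)
    is⁻¹γ⁻ = subst Neg (actInv-cong x∈W (InW-simpleWord is) (λ y → sym (is≈x y)) γ) x⁻¹γ⁻

  length-descent : ∀ {x γ l} → InW x → Pos γ → Neg (actInv x γ) →
                   LengthAtLeast (γ ∷ x) l → LengthAtLeast x (suc l)
  length-descent x∈W γ⁺ x⁻¹γ⁻ γx≥l is is≈x =
    let js , is▹js , γx≈js = exchange-≈ is x∈W is≈x γ⁺ x⁻¹γ⁻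
    in subst (_ ≤ℕ_) (sym (OneDeletion-length is▹js)) (s≤s (γx≥l js (λ y → sym (γx≈js y))))

  ascent⇒Pos : ∀ {x γ m} → InW x → Pos γ → HasWordOfLength x m →
               LengthAtLeast (γ ∷ x) (suc m) → Pos (actInv x γ)
  ascent⇒Pos {x} {γ} {m} x∈W γ⁺ (is , |is|≡m , is≈x) γx≥1+m =
    fromInj₁ (λ x⁻¹γ⁻ → ⊥-elim (ℕₚ.1+n≰n (ℕₚ.<⇒≤ (2+m≤m x⁻¹γ⁻)))) (Pos⊎Neg (actInv-root x∈W (proj₁ γ⁺)))
    where
    2+m≤m : Neg (actInv x γ) → suc (suc m) ≤ℕ m
    2+m≤m x⁻¹γ⁻ = subst (_ ≤ℕ_) |is|≡m (length-descent x∈W γ⁺ x⁻¹γ⁻ γx≥1+m is is≈x)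

  cover-inversion-Neg : ∀ {w v α m} → InW w → InW v → Pos α → v ≈W (α ∷ w) →
                        HasWordOfLength w m → LengthAtLeast v (suc m) → Neg (actInv v α)
  cover-inversion-Neg {w} {v} {α} w∈W v∈W α⁺ v≈αw w-word v≥1+m =
    subst Neg (sym v⁻¹α≡-w⁻¹α) (Pos⇒Neg-negV w⁻¹α⁺)
    where
    w⁻¹α⁺ : Pos (actInv w α)
    w⁻¹α⁺ = ascent⇒Pos w∈W α⁺ w-word (LengthAtLeast-cong v (α ∷ w) v≈αw v≥1+m)
    v⁻¹α≡-w⁻¹α : actInv v α ≡ negV (actInv w α)
    v⁻¹α≡-w⁻¹α = trans (actInv-cong v∈W (proj₁ α⁺ ∷ w∈W) v≈αw α) (actInv-reflecting-root (proj₁ α⁺) w)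

  one-deletion-from-sᵢ-word : ∀ {w v m} i J → length J ≡ m → simpleWord (i ∷ J) ≈W v →
                              LengthAtLeast (sᵢ i w) (suc m) → ¬ (sᵢ i w ≈W v) →
                              ∀ {L} → OneDeletion (i ∷ J) L → ¬ (simpleWord L ≈W w)
  one-deletion-from-sᵢ-word i J |J|≡m iJ≈v siw≥1+m siw≉v here J≈w =
    siw≉v (λ x → trans (cong (s (lookup Δ i)) (sym (J≈w x))) (iJ≈v x))
  one-deletion-from-sᵢ-word {w} i J |J|≡m iJ≈v siw≥1+m siw≉v (there {ys = L} J▹L) iL≈w =
    ℕₚ.1+n≰n (ℕₚ.<⇒≤ 2+|L|≤|L|)
    where
    2+|L|≤|L| : suc (suc (length L)) ≤ℕ length L
    2+|L|≤|L| = subst (λ l → suc l ≤ℕ length L) (trans (sym |J|≡m) (OneDeletion-length J▹L))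
                      (siw≥1+m L (λ x → sym (∷-swap (simpleWord L) w (simpleRoots i) iL≈w x)))

  cover-simple-¬descent : ∀ {w v α m} i → InW v → Pos α → Neg (actInv v α) → v ≈W (α ∷ w) →
                          HasWordOfLength v (suc m) → LengthAtLeast (sᵢ i w) (suc m) →
                          ¬ (sᵢ i w ≈W v) → ¬ Neg (actInv v (lookup Δ i))
  cover-simple-¬descent {w} {v} i v∈W α⁺ v⁻¹α⁻ v≈αw (J , |J|≡1+m , J≈v) siw≥1+m siw≉v v⁻¹αᵢ⁻ =
    let J′ , J▹J′ , αᵢv≈J′ = exchange-≈ J v∈W J≈v (simple-Pos i) v⁻¹αᵢ⁻
        iJ′≈v              = ∷-swap v (simpleWord J′) (simpleRoots i) αᵢv≈J′
        L , iJ′▹L , αv≈L   = exchange-≈ (i ∷ J′) v∈W iJ′≈v α⁺ v⁻¹α⁻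
        αv≈w               = ∷-swap w v (proj₁ α⁺) (λ y → sym (v≈αw y))
        |J′|≡m             = ℕₚ.suc-injective (trans (sym (OneDeletion-length J▹J′)) |J|≡1+m)
        L≈w : simpleWord L ≈W w
        L≈w x              = trans (sym (αv≈L x)) (αv≈w x)
    in one-deletion-from-sᵢ-word {w} {v} i J′ |J′|≡m iJ′≈v siw≥1+m siw≉v iJ′▹L L≈w

  cover-simple-ascent : ∀ {w v α m} i → InW v → Pos α → Neg (actInv v α) → v ≈W (α ∷ w) →
                        HasWordOfLength v (suc m) → LengthAtLeast (sᵢ i w) (suc m) →
                        ¬ (sᵢ i w ≈W v) → Pos (actInv v (lookup Δ i))
  cover-simple-ascent {w} i v∈W α⁺ v⁻¹α⁻ v≈αw v-word siw≥1+m siw≉v =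
    fromInj₁ (⊥-elim ∘ cover-simple-¬descent {w} i v∈W α⁺ v⁻¹α⁻ v≈αw v-word siw≥1+m siw≉v)
             (Pos⊎Neg (actInv-root v∈W (simpleRoots i)))

  module _ {𝔥 : V n → Set} where

    Edge-cong : ∀ {u u′ w w′} → InW w → InW w′ → u ≈W u′ → w ≈W w′ → Edge 𝔥 u w → Edge 𝔥 u′ w′
    Edge-cong w∈W w′∈W u≈u′ w≈w′ (α , α⁺ , w≈αu , h) =
      α , α⁺ , (λ x → trans (sym (w≈w′ x)) (trans (w≈αu x) (cong (s α) (u≈u′ x)))) ,
      subst (λ y → 𝔥 (negV y)) (actInv-cong w∈W w′∈W w≈w′ α) h

    Edge-sᵢ : ∀ i {u w} → ¬ (sᵢ i u ≈W w) → Edge 𝔥 u w → Edge 𝔥 (sᵢ i u) (sᵢ i w)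
    Edge-sᵢ i {u} {w} siu≉w (α , α⁺ , w≈αu , h) =
      s αᵢ α , s-simple-Pos i α⁺ α≢αᵢ , siw≈ , subst (λ y → 𝔥 (negV y)) (sym same-root) h
      where
      αᵢ : V n
      αᵢ = lookup Δ i
      αᵢ≢0 : ⟨ αᵢ , αᵢ ⟩ ≢ 0ℚ
      αᵢ≢0 = root-nonisotropic (simpleRoots i)
      α≢0 : ⟨ α , α ⟩ ≢ 0ℚ
      α≢0 = root-nonisotropic (proj₁ α⁺)
      α≢αᵢ : α ≢ αᵢ
      α≢αᵢ refl = siu≉w (λ x → sym (w≈αu x))
      siw≈ : sᵢ i w ≈W (s αᵢ α ∷ sᵢ i u)
      siw≈ x = begin
        s αᵢ (act w x)                      ≡⟨ cong (s αᵢ) (w≈αu x) ⟩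
        s αᵢ (s α (act u x))                ≡⟨ cong (λ y → s αᵢ (s α y)) (s-involutive αᵢ αᵢ≢0 (act u x)) ⟨
        s αᵢ (s α (s αᵢ (s αᵢ (act u x))))  ≡⟨ s-conj α αᵢ α≢0 αᵢ≢0 (s αᵢ (act u x)) ⟨
        s (s αᵢ α) (s αᵢ (act u x))         ∎
        where open ≡-Reasoning
      same-root : actInv (sᵢ i w) (s αᵢ α) ≡ actInv w α
      same-root = trans (actInv-∷ αᵢ w (s αᵢ α)) (cong (actInv w) (s-involutive αᵢ αᵢ≢0 α))

    Edge-sᵢ-⇔ : ∀ i {u w} → InW w → ¬ (sᵢ i u ≈W w) → Edge 𝔥 u w ⇔ Edge 𝔥 (sᵢ i u) (sᵢ i w)
    Edge-sᵢ-⇔ i {u} {w} w∈W siu≉w = mk⇔ (Edge-sᵢ i {u} {w} siu≉w) λ e →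
      Edge-cong {sᵢ i (sᵢ i u)} {u} (αᵢ∈Φ ∷ αᵢ∈Φ ∷ w∈W) w∈W (sᵢ-involutive i u) (sᵢ-involutive i w)
                (Edge-sᵢ i {sᵢ i u} {sᵢ i w} (λ sᵢsᵢu≈sᵢw → siu≉w (sᵢ-injective i (sᵢ i u) w sᵢsᵢu≈sᵢw)) e)
      where
      αᵢ∈Φ : lookup Δ i ∈ Φ
      αᵢ∈Φ = simpleRoots i

mainTheorem10 : ∀ {n k : ℕ} (G : Vec (Vec ℚ n) n) (Φ : List (Vec ℚ n)) (Δ : Vec (Vec ℚ n) k) →
    let open RS G Φ Δ in
    IsCrystallographicRootSystemWithBase →
    ∀ (𝔥 : Vec ℚ n → Set) → IsHessenberg 𝔥 →
    ∀ (w v : Word) → InW w → InW v →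
    IsCover v w →
    ∀ (i : Fin k) (m : ℕ) →
    IsLength w m → IsLength (sᵢ i w) (suc m) → IsLength v (suc m) →
    ¬ (sᵢ i w ≈W v) →
    (v <B sᵢ i v × IsLength (sᵢ i v) (suc (suc m))) ×
    (Edge 𝔥 w v ⇔ Edge 𝔥 (sᵢ i w) (sᵢ i v))
mainTheorem10 G Φ Δ R 𝔥 _ w v w∈W v∈W ((α , α⁺ , v≈αw) , _) i m
              (w-word , _) (_ , siw≥1+m) (v-word@(J , |J|≡1+m , J≈v) , v≥1+m) siw≉v =
  (v<siv , siv-word , siv≥2+m) , Edge-sᵢ-⇔ {𝔥} i {w} v∈W siw≉v
  where
  open RS G Φ Δ hiding (trans)
  open IsCrystallographicRootSystemWithBase R using (simpleRoots)
  open WeylGroup G Φ Δ R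
  v⁻¹α⁻ : Neg (actInv v α)
  v⁻¹α⁻ = cover-inversion-Neg w∈W v∈W α⁺ v≈αw w-word v≥1+m
  v⁻¹αᵢ⁺ : Pos (actInv v (lookup Δ i))
  v⁻¹αᵢ⁺ = cover-simple-ascent {w} i v∈W α⁺ v⁻¹α⁻ v≈αw v-word siw≥1+m siw≉v
  siv⁻¹αᵢ⁻ : Neg (actInv (sᵢ i v) (lookup Δ i))
  siv⁻¹αᵢ⁻ = subst Neg (sym (actInv-reflecting-root (simpleRoots i) v)) (Pos⇒Neg-negV v⁻¹αᵢ⁺)
  v<siv : v <B sᵢ i v
  v<siv = step (lookup Δ i) (simple-Pos i) (λ _ → refl) siv⁻¹αᵢ⁻
  siv-word : HasWordOfLength (sᵢ i v) (suc (suc m))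
  siv-word = i ∷ J , cong suc |J|≡1+m , λ x → cong (s (lookup Δ i)) (J≈v x)
  siv≥2+m : LengthAtLeast (sᵢ i v) (suc (suc m))
  siv≥2+m = length-descent (simpleRoots i ∷ v∈W) (simple-Pos i) siv⁻¹αᵢ⁻
                           (LengthAtLeast-cong v (sᵢ i (sᵢ i v)) (λ x → sym (sᵢ-involutive i v x)) v≥1+m)
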